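{- For every integer $q\ge 3$, $p_3^*(3,q)\le f_3^*(q,6,3)\le p_3(3,q)$.
   Context: A $PHF(N;n,q,t)$ is an $N\times n$ matrix over $[q]$ such that for every set of $t$ columns there is a row in which these $t$ columns have pairwise distinct entries; $p_t(N,q)$ is the maximum $n$ for which such a matrix exists. A column $x$ has a unique coordinate $i$ if $y(i)\ne x(i)$ for every other column $y$; a $PHF^*(N;n,q,t)$ is a $PHF(N;n,q,t)$ in which no column has a unique coordinate, and $p_t^*(N,q)$ is the maximum $n$ for which a $PHF^*(N;n,q,t)$ exists. An $r$-uniform hypergraph is $G(v,e)$-free if the union of any $e$ distinct edges has at least $v+1$ vertices. $f_r^*(q,v,e)$ is the maximum number of edges of a $G(v,e)$-free $r$-uniform $r$-partite hypergraph whose $r$ parts each have exactly $q$ vertices (each edge meets each part in exactly one vertex). -}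

module Defs where

open import Data.Nat using (ℕ; suc; _≤_)
open import Data.Fin using (Fin; combine)
open import Data.Fin.Subset using (Subset; ⋃; ⁅_⁆; ∣_∣)
open import Data.List using (map; allFin)
open import Data.Product using (Σ; ∃; _×_)
open import Function.Definitions using (Injective)
open import Relation.Binary.PropositionalEquality using (_≡_; _≢_)
open import Relation.Nullary using (¬_)

-- An N × n matrix over [q]: M i x = entry in row i, column x.
Matrix : ℕ → ℕ → ℕ → Set
Matrix N n q = Fin N → Fin n → Fin q

-- PHF(N;n,q,t): for every set of t (distinct) columns, given by an injective
-- map c : Fin t → Fin n, some row separates them (entries pairwise distinct).
IsPHF : (N n q t : ℕ) → Matrix N n q → Set
IsPHF N n q t M =
  (c : Fin t → Fin n) → Injective _≡_ _≡_ c →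
  Σ (Fin N) λ i → Injective _≡_ _≡_ (λ k → M i (c k))

UniqueCoord : {N n q : ℕ} → Matrix N n q → Fin n → Fin N → Set
UniqueCoord M x i = ∀ y → y ≢ x → M i y ≢ M i x

IsPHF* : (N n q t : ℕ) → Matrix N n q → Set
IsPHF* N n q t M = IsPHF N n q t M × (∀ x i → ¬ UniqueCoord M x i)

-- p_t(N,q) = n  :  n is the maximum number of columns of a PHF(N;n,q,t).
IsMaxPHF : (t N q n : ℕ) → Set
IsMaxPHF t N q n =
  (Σ (Matrix N n q) (IsPHF N n q t)) ×
  (∀ m → Σ (Matrix N m q) (IsPHF N m q t) → m ≤ n)

IsMaxPHF* : (t N q n : ℕ) → Set
IsMaxPHF* t N q n =
  (Σ (Matrix N n q) (IsPHF* N n q t)) ×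
  (∀ m → Σ (Matrix N m q) (IsPHF* N m q t) → m ≤ n)

-- r-uniform r-partite hypergraph with parts of exactly q vertices each.
-- Vertex set: r parts of q vertices, vertex (j , a) encoded as combine j a : Fin (r * q).
-- An edge meets each part in exactly one vertex, so it is a map Fin r → Fin q.
-- A hypergraph with m edges is an injective family (the edges are distinct).
Edge : ℕ → ℕ → Set
Edge r q = Fin r → Fin q

Hypergraph : ℕ → ℕ → ℕ → Set
Hypergraph r q m = Σ (Fin m → Edge r q) (Injective _≡_ _≡_)

edgeVertices : {r q : ℕ} → Edge r q → Subset (r Data.Nat.* q)
edgeVertices {r} x = ⋃ (map (λ j → ⁅ combine j (x j) ⁆) (allFin r))

GFree : {r q m : ℕ} → (v e : ℕ) → Hypergraph r q m → Set
GFree {r} {q} {m} v e H =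
  (s : Fin e → Fin m) → Injective _≡_ _≡_ s →
  suc v ≤ ∣ ⋃ (map (λ k → edgeVertices (Σ.proj₁ H (s k))) (allFin e)) ∣

IsMaxF* : (r q v e n : ℕ) → Set
IsMaxF* r q v e n =
  (Σ (Hypergraph r q n) (GFree v e)) ×
  (∀ m → Σ (Hypergraph r q m) (GFree v e) → m ≤ n)

module Submission where

-- Both inequalities read an N × n matrix over [q] as an N-partite N-uniform
-- hypergraph: column x is the edge meeting part j in the vertex M j x.
--
-- f* ≤ p.  Three distinct edges of a G(6,3)-free hypergraph span at least
--   seven vertices.  If no row separated them, each part would contain at most
--   two of those vertices, six in total.  The argument works for any number r
--   of parts: a G(2r,3)-free r-partite hypergraph is a PHF(r;m,q,3).
-- p* ≤ f*.  In a PHF*, two distinct columns never agree off a single row a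
--   (the first would have a unique coordinate at a).  Three columns of a
--   PHF*(3;n,q,3) are separated by some row, giving three vertices there, and
--   the two other rows then contribute at least four more: seven in all.
--   If n < 3 instead, n ≤ 2 ≤ f* is witnessed by a two-edge hypergraph.

open import Defs
open import Data.Nat using (ℕ; _≤_)
open import Data.Product using (_×_)

open import Data.Nat using (_+_; _*_; _<_; z≤n; s≤s; _≤?_)
open import Data.Nat.Properties
  using (≤-trans; ≤-refl; ≤-reflexive; ≤-pred; +-mono-≤; +-monoʳ-≤; +-suc; +-identityʳ; n≤1+n; n<1+n; <-irrefl; ≰⇒>)
open import Data.Product using (Σ; ∃; ∃₂; _,_; proj₁; proj₂)
open import Data.Sum using (_⊎_; inj₁; inj₂; [_,_])
open import Data.Empty using (⊥; ⊥-elim)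
open import Data.Fin as Fin using (Fin; combine; inject≤; _≟_)
open import Data.Fin.Patterns using (0F; 1F; 2F)
open import Data.Fin.Properties
  using (combine-injectiveˡ; combine-injectiveʳ; inject≤-injective; pigeonhole; <⇒≢; ¬∀⟶∃¬)
open import Data.Fin.Permutation using (Permutation; transpose; _⟨$⟩ʳ_; _⟨$⟩ˡ_; inverseʳ)
open import Data.Fin.Subset using (Subset; ⋃; ⁅_⁆; ∣_∣; _∪_; _-_; _⊆_; ⊤; inside; outside; _∈_)
open import Data.Fin.Subset.Properties
  using (x∈⁅x⁆; x∈⁅y⁆⇒x≡y; ∉⊥; x∈p∪q⁻; p⊆p∪q; q⊆p∪q; x∈p∧x≢y⇒x∈p-y; x∈p⇒∣p-x∣<∣p∣;
         p⊆q⇒∣p∣≤∣q∣; ∣⁅x⁆∣≡1; ∣⊥∣≡0; ∣⊤∣≡n; ∣p∣≤∣x∷p∣)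
open import Data.Vec using ([]; _∷_)
open import Data.List using (List; []; _∷_; _++_; map; length; tabulate; concat; allFin)
open import Data.Nat.ListAction using (sum)
open import Data.List.Properties using (length-++; length-map; length-tabulate)
open import Data.List.Relation.Unary.All as All using (All; []; _∷_)
import Data.List.Relation.Unary.All.Properties as AllP
open import Data.List.Relation.Unary.Any using (Any; here; there)
import Data.List.Relation.Unary.Any as Any
import Data.List.Relation.Unary.Any.Properties as AnyP
open import Data.List.Relation.Unary.AllPairs using ([]; _∷_)
import Data.List.Relation.Unary.AllPairs.Properties as AllPairsP
open import Data.List.Relation.Unary.Unique.Propositional using (Unique)
import Data.List.Relation.Unary.Unique.Propositional.Properties as UniqueP
open import Data.List.Relation.Binary.Disjoint.Propositional using (Disjoint)
open import Data.List.Membership.Propositional using () renaming (_∈_ to _∈ₗ_)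
open import Data.List.Membership.Propositional.Properties using (∈-map⁻; ∈-++⁺ˡ; ∈-++⁺ʳ)
open import Function using (_∘_)
open import Function.Bundles using (Injection)
open import Function.Definitions using (Injective)
open import Function.Properties.Inverse using (↔⇒↣)
open import Relation.Binary.Definitions using (DecidableEquality)
open import Relation.Binary.PropositionalEquality
  using (_≡_; _≢_; refl; sym; trans; cong; cong₂; cong-app; subst; ≢-sym; module ≡-Reasoning)
open import Relation.Nullary using (¬_; yes; no)

∣p∪q∣≤∣p∣+∣q∣ : ∀ {n} (p q : Subset n) → ∣ p ∪ q ∣ ≤ ∣ p ∣ + ∣ q ∣
∣p∪q∣≤∣p∣+∣q∣ [] [] = z≤n
∣p∪q∣≤∣p∣+∣q∣ (inside ∷ p) (s ∷ q) =
  s≤s (≤-trans (∣p∪q∣≤∣p∣+∣q∣ p q) (+-monoʳ-≤ ∣ p ∣ (∣p∣≤∣x∷p∣ s q)))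
∣p∪q∣≤∣p∣+∣q∣ (outside ∷ p) (inside ∷ q) =
  ≤-trans (s≤s (∣p∪q∣≤∣p∣+∣q∣ p q)) (≤-reflexive (sym (+-suc ∣ p ∣ ∣ q ∣)))
∣p∪q∣≤∣p∣+∣q∣ (outside ∷ p) (outside ∷ q) = ∣p∪q∣≤∣p∣+∣q∣ p q

∈⋃⁺ : ∀ {n} {x : Fin n} (ps : List (Subset n)) → Any (x ∈_) ps → x ∈ ⋃ ps
∈⋃⁺ (p ∷ ps) (here x∈p) = p⊆p∪q (⋃ ps) x∈p
∈⋃⁺ (p ∷ ps) (there x∈ps) = q⊆p∪q p (⋃ ps) (∈⋃⁺ ps x∈ps)

∈⋃⁻ : ∀ {n} {x : Fin n} (ps : List (Subset n)) → x ∈ ⋃ ps → Any (x ∈_) ps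
∈⋃⁻ [] x∈∅ = ⊥-elim (∉⊥ x∈∅)
∈⋃⁻ (p ∷ ps) x∈⋃ with x∈p∪q⁻ p (⋃ ps) x∈⋃
... | inj₁ x∈p = here x∈p
... | inj₂ x∈ps = there (∈⋃⁻ ps x∈ps)

∣⋃⁅⁆∣≤length : ∀ {n} (vs : List (Fin n)) → ∣ ⋃ (map ⁅_⁆ vs) ∣ ≤ length vs
∣⋃⁅⁆∣≤length {n} [] = ≤-reflexive (∣⊥∣≡0 n)
∣⋃⁅⁆∣≤length (v ∷ vs) =
  ≤-trans (∣p∪q∣≤∣p∣+∣q∣ ⁅ v ⁆ _) (+-mono-≤ (≤-reflexive (∣⁅x⁆∣≡1 v)) (∣⋃⁅⁆∣≤length vs))

∣p∣≤length : ∀ {n} (p : Subset n) (vs : List (Fin n)) →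
  (∀ {x} → x ∈ p → x ∈ₗ vs) → ∣ p ∣ ≤ length vs
∣p∣≤length p vs covered = ≤-trans (p⊆q⇒∣p∣≤∣q∣ p⊆⋃) (∣⋃⁅⁆∣≤length vs)
  where
  p⊆⋃ : p ⊆ ⋃ (map ⁅_⁆ vs)
  p⊆⋃ x∈p = ∈⋃⁺ (map ⁅_⁆ vs) (AnyP.map⁺ (Any.map (λ { refl → x∈⁅x⁆ _ }) (covered x∈p)))

length≤∣p∣ : ∀ {n} {p : Subset n} (xs : List (Fin n)) →
  Unique xs → All (_∈ p) xs → length xs ≤ ∣ p ∣
length≤∣p∣ [] _ _ = z≤n
length≤∣p∣ {p = p} (x ∷ xs) (x∉xs ∷ unique) (x∈p ∷ xs⊆p) =
  ≤-trans (s≤s (length≤∣p∣ xs unique xs⊆p-x)) (x∈p⇒∣p-x∣<∣p∣ x∈p)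
  where
  xs⊆p-x : All (_∈ p - x) xs
  xs⊆p-x = All.zipWith (λ (x≢y , y∈p) → x∈p∧x≢y⇒x∈p-y y∈p (≢-sym x≢y)) (x∉xs , xs⊆p)

avoidTwo : ∀ {n} → 3 ≤ n → (x y : Fin n) → ∃ λ z → z ≢ x × z ≢ y
avoidTwo {n} 3≤n x y with ¬∀⟶∃¬ n (_∈ₗ x ∷ y ∷ []) (λ z → Any.any? (z ≟_) (x ∷ y ∷ [])) notAllCovered
  where
  notAllCovered : ¬ (∀ z → z ∈ₗ x ∷ y ∷ [])
  notAllCovered covered = absurd (≤-trans 3≤n n≤2)
    where
    n≤2 : n ≤ 2
    n≤2 = subst (_≤ 2) (∣⊤∣≡n n) (∣p∣≤length ⊤ (x ∷ y ∷ []) (λ {z} _ → covered z))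
    absurd : ¬ (3 ≤ 2)
    absurd (s≤s (s≤s ()))
... | z , z∉ = z , (λ z≡x → z∉ (here z≡x)) , (λ z≡y → z∉ (there (here z≡y)))

Distinct₃ : {A : Set} → A → A → A → Set
Distinct₃ x y z = x ≢ y × x ≢ z × y ≢ z

injective₃ : {A : Set} (t : Fin 3 → A) → Distinct₃ (t 0F) (t 1F) (t 2F) → Injective _≡_ _≡_ t
injective₃ t d {0F} {0F} _ = refl
injective₃ t (t01 , t02 , t12) {0F} {1F} e = ⊥-elim (t01 e)
injective₃ t (t01 , t02 , t12) {0F} {2F} e = ⊥-elim (t02 e)
injective₃ t (t01 , t02 , t12) {1F} {0F} e = ⊥-elim (t01 (sym e))
injective₃ t d {1F} {1F} _ = refl
injective₃ t (t01 , t02 , t12) {1F} {2F} e = ⊥-elim (t12 e)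
injective₃ t (t01 , t02 , t12) {2F} {0F} e = ⊥-elim (t02 (sym e))
injective₃ t (t01 , t02 , t12) {2F} {1F} e = ⊥-elim (t12 (sym e))
injective₃ t d {2F} {2F} _ = refl

injective₃⁻ : {A : Set} (t : Fin 3 → A) → Injective _≡_ _≡_ t → Distinct₃ (t 0F) (t 1F) (t 2F)
injective₃⁻ t t-inj = (λ e → 0≢1 (t-inj e)) , (λ e → 0≢2 (t-inj e)) , (λ e → 1≢2 (t-inj e))
  where
  0≢1 : _≢_ {A = Fin 3} 0F 1F
  0≢1 ()
  0≢2 : _≢_ {A = Fin 3} 0F 2F
  0≢2 ()
  1≢2 : _≢_ {A = Fin 3} 1F 2F
  1≢2 ()

triple : {A : Set} → A → A → A → Fin 3 → A
triple x y z 0F = x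
triple x y z 1F = y
triple x y z 2F = z

TwoValued : {A : Set} {n : ℕ} → (Fin n → A) → Set
TwoValued {A} t = ∃₂ λ (u w : A) → ∀ k → t k ≡ u ⊎ t k ≡ w

injectiveOrTwoValued : {A : Set} → DecidableEquality A →
  (t : Fin 3 → A) → Injective _≡_ _≡_ t ⊎ TwoValued t
injectiveOrTwoValued _≟ᴬ_ t with t 0F ≟ᴬ t 1F | t 0F ≟ᴬ t 2F | t 1F ≟ᴬ t 2F
... | yes t01 | _ | _ = inj₂ (t 0F , t 2F , λ { 0F → inj₁ refl ; 1F → inj₁ (sym t01) ; 2F → inj₂ refl })
... | no _ | yes t02 | _ = inj₂ (t 0F , t 1F , λ { 0F → inj₁ refl ; 1F → inj₂ refl ; 2F → inj₁ (sym t02) })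
... | no _ | no _ | yes t12 = inj₂ (t 0F , t 1F , λ { 0F → inj₁ refl ; 1F → inj₂ refl ; 2F → inj₂ (sym t12) })
... | no t01 | no t02 | no t12 = inj₁ (injective₃ t (t01 , t02 , t12))

someOrAll : ∀ {n} {P Q : Fin n → Set} → (∀ j → P j ⊎ Q j) → (∃ P) ⊎ (∀ j → Q j)
someOrAll {ℕ.zero} _ = inj₂ λ ()
someOrAll {ℕ.suc n} {P} {Q} choice with choice Fin.zero | someOrAll {P = P ∘ Fin.suc} {Q ∘ Fin.suc} (choice ∘ Fin.suc)
... | inj₁ p | _ = inj₁ (Fin.zero , p)
... | inj₂ _ | inj₁ (j , p) = inj₁ (Fin.suc j , p)
... | inj₂ q | inj₂ qs = inj₂ λ { Fin.zero → q ; (Fin.suc j) → qs j }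

Values : {A : Set} {n : ℕ} → (Fin n → A) → Set
Values {A} t = Σ (List A) λ vs → Unique vs × All (λ v → ∃ λ k → t k ≡ v) vs

size : {A : Set} {n : ℕ} {t : Fin n → A} → Values t → ℕ
size = length ∘ proj₁

value₁ : {A : Set} {n : ℕ} (t : Fin n → A) (k : Fin n) → Values t
value₁ t k = t k ∷ [] , [] ∷ [] , (k , refl) ∷ []

value₂ : {A : Set} {n : ℕ} (t : Fin n → A) {k l : Fin n} → t k ≢ t l → Values t
value₂ t {k} {l} tk≢tl = t k ∷ t l ∷ [] , (tk≢tl ∷ []) ∷ [] ∷ [] , (k , refl) ∷ (l , refl) ∷ []

values₃ : {A : Set} (t : Fin 3 → A) → Injective _≡_ _≡_ t → Values t
values₃ t t-inj with injective₃⁻ t t-inj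
... | t01 , t02 , t12 =
  t 0F ∷ t 1F ∷ t 2F ∷ [] , (t01 ∷ t02 ∷ []) ∷ (t12 ∷ []) ∷ [] ∷ [] , (0F , refl) ∷ (1F , refl) ∷ (2F , refl) ∷ []

-- Two triples x, y in which no two positions agree in both take at least four
-- distinct values together: whatever x identifies, y must separate.
jointValues : {A : Set} → DecidableEquality A → (x y : Fin 3 → A) →
  (∀ {k l} → k ≢ l → x k ≡ x l → y k ≢ y l) →
  Σ (Values x × Values y) λ (vx , vy) → 4 ≤ size vx + size vy
jointValues _≟ᴬ_ x y apart with x 0F ≟ᴬ x 1F | x 0F ≟ᴬ x 2F | y 0F ≟ᴬ y 1F | y 0F ≟ᴬ y 2F
... | no x01 | _ | no y01 | _ = (value₂ x x01 , value₂ y y01) , ≤-refl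
... | no x01 | _ | yes y01 | no y02 = (value₂ x x01 , value₂ y y02) , ≤-refl
... | no x01 | _ | yes y01 | yes y02 =
  (values₃ x (injective₃ x (x01 , (λ x02 → apart (λ ()) x02 y02) , λ x12 → apart (λ ()) x12 (trans (sym y01) y02)))
  , value₁ y 0F) , ≤-refl
... | yes x01 | yes x02 | _ | _ =
  (value₁ x 0F , values₃ y (injective₃ y (apart (λ ()) x01 , apart (λ ()) x02 , apart (λ ()) (trans (sym x01) x02))))
  , ≤-refl
... | yes x01 | no x02 | _ | _ = (value₂ x x02 , value₂ y (apart (λ ()) x01)) , ≤-refl

span : ∀ {r q m} → (Fin m → Edge r q) → Subset (r * q)
span {m = m} E = ⋃ (map (λ k → edgeVertices (E k)) (allFin m))

∈span⁺ : ∀ {r q m} (E : Fin m → Edge r q) (k : Fin m) (j : Fin r) → combine j (E k j) ∈ span E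
∈span⁺ E k j =
  ∈⋃⁺ _ (AnyP.map⁺ (AnyP.tabulate⁺ k (∈⋃⁺ _ (AnyP.map⁺ (AnyP.tabulate⁺ j (x∈⁅x⁆ _))))))

∈span⁻ : ∀ {r q m} (E : Fin m → Edge r q) {v : Fin (r * q)} →
  v ∈ span E → ∃₂ λ k j → v ≡ combine j (E k j)
∈span⁻ E v∈E with AnyP.tabulate⁻ (AnyP.map⁻ (∈⋃⁻ _ v∈E))
... | k , v∈Ek with AnyP.tabulate⁻ (AnyP.map⁻ (∈⋃⁻ _ v∈Ek))
... | j , v∈⁅⁆ = k , j , x∈⁅y⁆⇒x≡y _ v∈⁅⁆

valuesInSpan : ∀ {r q m} (E : Fin m → Edge r q) (j : Fin r) (vs : Values (λ k → E k j)) →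
  All (λ u → combine j u ∈ span E) (proj₁ vs)
valuesInSpan E j (_ , _ , taken) = All.map (λ { (k , refl) → ∈span⁺ E k j }) taken

length-blocks : ∀ {n} {A B : Set} (g : Fin n → A → B) (L : Fin n → List A) →
  length (concat (tabulate (λ i → map (g i) (L i)))) ≡ sum (tabulate (λ i → length (L i)))
length-blocks {ℕ.zero} g L = refl
length-blocks {ℕ.suc n} g L = begin
  length (map (g Fin.zero) (L Fin.zero) ++ rest)
    ≡⟨ length-++ (map (g Fin.zero) (L Fin.zero)) ⟩
  length (map (g Fin.zero) (L Fin.zero)) + length rest
    ≡⟨ cong₂ _+_ (length-map (g Fin.zero) (L Fin.zero)) (length-blocks (g ∘ Fin.suc) (L ∘ Fin.suc)) ⟩
  length (L Fin.zero) + sum (tabulate (λ i → length (L (Fin.suc i)))) ∎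
  where
  open ≡-Reasoning
  rest = concat (tabulate (λ i → map (g (Fin.suc i)) (L (Fin.suc i))))

-- Lower bound: vertices chosen in distinct parts p i, duplicate-free within
-- each part, are all distinct, so a set containing them is at least as large
-- as their total number.
blocksBound : ∀ {r q n} (S : Subset (r * q)) (p : Fin n → Fin r) → Injective _≡_ _≡_ p →
  (L : Fin n → List (Fin q)) → (∀ i → Unique (L i)) → (∀ i → All (λ u → combine (p i) u ∈ S) (L i)) →
  sum (tabulate (λ i → length (L i))) ≤ ∣ S ∣
blocksBound {r} {q} {n} S p p-inj L unique inS =
  subst (_≤ ∣ S ∣) (length-blocks (combine ∘ p) L) (length≤∣p∣ vertices distinct vertices⊆S)
  where
  block : Fin n → List (Fin (r * q))
  block i = map (combine (p i)) (L i)
  vertices : List (Fin (r * q))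
  vertices = concat (tabulate block)
  disjoint : ∀ {i j} → i ≢ j → Disjoint (block i) (block j)
  disjoint {i} {j} i≢j (v∈i , v∈j) with ∈-map⁻ (combine (p i)) v∈i | ∈-map⁻ (combine (p j)) v∈j
  ... | u , _ , refl | w , _ , same = i≢j (p-inj (combine-injectiveˡ _ u _ w same))
  distinct : Unique vertices
  distinct = UniqueP.concat⁺
    (AllP.tabulate⁺ (λ i → UniqueP.map⁺ (combine-injectiveʳ {m = r} (p i) _ (p i) _) (unique i)))
    (AllPairsP.tabulate⁺ disjoint)
  vertices⊆S : All (_∈ S) vertices
  vertices⊆S = AllP.concat⁺ (AllP.tabulate⁺ (λ i → AllP.map⁺ (inS i)))

twoValuedBound : ∀ {r q m} (E : Fin m → Edge r q) → (∀ j → TwoValued (λ k → E k j)) → ∣ span E ∣ ≤ r + r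
twoValuedBound {r} {q} E twoValued = ≤-trans (∣p∣≤length (span E) cover covered) (≤-reflexive length-cover)
  where
  u w : Fin r → Fin q
  u j = proj₁ (twoValued j)
  w j = proj₁ (proj₂ (twoValued j))
  cover : List (Fin (r * q))
  cover = tabulate (λ j → combine j (u j)) ++ tabulate (λ j → combine j (w j))
  covered : ∀ {v} → v ∈ span E → v ∈ₗ cover
  covered v∈E with ∈span⁻ E v∈E
  ... | k , j , refl with proj₂ (proj₂ (twoValued j)) k
  ... | inj₁ Ekj≡u = ∈-++⁺ˡ (AnyP.tabulate⁺ j (cong (combine j) Ekj≡u))
  ... | inj₂ Ekj≡w = ∈-++⁺ʳ _ (AnyP.tabulate⁺ j (cong (combine j) Ekj≡w))
  length-cover : length cover ≡ r + r
  length-cover = trans (length-++ (tabulate (λ j → combine j (u j))))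
    (cong₂ _+_ (length-tabulate (λ j → combine j (u j))) (length-tabulate (λ j → combine j (w j))))

fewEdgesFree : ∀ {r q m} v e (H : Hypergraph r q m) → m < e → GFree v e H
fewEdgesFree v e H m<e s s-inj with pigeonhole m<e s
... | i , j , i<j , si≡sj = ⊥-elim (<⇒≢ i<j (s-inj si≡sj))

twoEdges : ∀ r {q} → 2 ≤ q → Hypergraph (ℕ.suc r) q 2
twoEdges r 2≤q =
  (λ k _ → inject≤ k 2≤q) , λ {x} {y} same → inject≤-injective 2≤q 2≤q x y (cong-app same Fin.zero)

columns : ∀ {N n q} → Matrix N n q → Fin n → Edge N q
columns M x j = M j x

incidence : ∀ {r q m} → Hypergraph r q m → Matrix r m q
incidence H j x = proj₁ H x j

-- f* ≤ p for any number r of parts: three distinct edges of a G(2r,3)-free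
-- hypergraph span more than 2r vertices, so some part meets them in three
-- distinct vertices, i.e. some row of the incidence matrix separates them.
freeIsPHF : ∀ {r q m} (H : Hypergraph r q m) → GFree (r + r) 3 H → IsPHF r m q 3 (incidence H)
freeIsPHF H free c c-inj with someOrAll (λ j → injectiveOrTwoValued _≟_ (λ k → proj₁ H (c k) j))
... | inj₁ separatingRow = separatingRow
... | inj₂ twoValued =
  ⊥-elim (<-irrefl refl (≤-trans (free c c-inj) (twoValuedBound (λ k → proj₁ H (c k)) twoValued)))

module ColumnsOfPHF {N n q} (M : Matrix N n q) (phf : IsPHF N n q 3 M) where

  separatingRow : ∀ {x y z} → Distinct₃ x y z → ∃ λ i → Distinct₃ (M i x) (M i y) (M i z)
  separatingRow {x} {y} {z} d with phf (triple x y z) (injective₃ (triple x y z) d)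
  ... | i , separated = i , injective₃⁻ (λ k → M i (triple x y z k)) separated

  -- With at least three columns, distinct columns differ in some row: a third
  -- column together with them is separated by some row.
  distinctColumns : 3 ≤ n → ∀ {x y} → x ≢ y → ∃ λ i → M i x ≢ M i y
  distinctColumns 3≤n {x} {y} x≢y with avoidTwo 3≤n x y
  ... | z , z≢x , z≢y with separatingRow (x≢y , ≢-sym z≢x , ≢-sym z≢y)
  ... | i , Mix≢Miy , _ = i , Mix≢Miy

  columnsInjective : 3 ≤ n → Injective _≡_ _≡_ (columns M)
  columnsInjective 3≤n {x} {y} same with x ≟ y
  ... | yes x≡y = x≡y
  ... | no x≢y with distinctColumns 3≤n x≢y
  ... | i , Mix≢Miy = ⊥-elim (Mix≢Miy (cong-app same i))

  -- In a PHF*, two distinct columns x, y never agree in all rows but one row a: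
  -- otherwise x has the unique coordinate a.  A column w ≠ x agreeing with x
  -- in row a is either y, which then equals x everywhere, or forms with x and y
  -- a triple whose separating row can be neither a nor any other row.
  agreeOffRow : 3 ≤ n → (∀ x i → ¬ UniqueCoord M x i) →
    ∀ {x y} a → x ≢ y → (∀ i → i ≢ a → M i x ≡ M i y) → ⊥
  agreeOffRow 3≤n noUnique {x} {y} a x≢y agree = noUnique x a uniqueAtA
    where
    uniqueAtA : UniqueCoord M x a
    uniqueAtA w w≢x Maw≡Max with w ≟ y
    uniqueAtA w w≢x Maw≡Max | yes refl with distinctColumns 3≤n x≢y
    ... | i , Mix≢Miy with i ≟ a
    ... | yes refl = Mix≢Miy (sym Maw≡Max)
    ... | no i≢a = Mix≢Miy (agree i i≢a)
    uniqueAtA w w≢x Maw≡Max | no w≢y with separatingRow (x≢y , ≢-sym w≢x , ≢-sym w≢y)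
    ... | i , Mix≢Miy , Mix≢Miw , _ with i ≟ a
    ... | yes refl = Mix≢Miw (sym Maw≡Max)
    ... | no i≢a = Mix≢Miy (agree i i≢a)

otherRows : (σ : Permutation 3 3) → ∀ i → i ≢ σ ⟨$⟩ʳ 0F → i ≡ σ ⟨$⟩ʳ 1F ⊎ i ≡ σ ⟨$⟩ʳ 2F
otherRows σ i i≢σ0 with σ ⟨$⟩ˡ i | inverseʳ σ {i}
... | 0F | σ0≡i = ⊥-elim (i≢σ0 (sym σ0≡i))
... | 1F | σ1≡i = inj₁ (sym σ1≡i)
... | 2F | σ2≡i = inj₂ (sym σ2≡i)

module PHF*IsFree {n q} (M : Matrix 3 n q) (phf : IsPHF 3 n q 3 M)
  (noUnique : ∀ x i → ¬ UniqueCoord M x i) (3≤n : 3 ≤ n) where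
  open ColumnsOfPHF M phf

  hypergraph : Hypergraph 3 q n
  hypergraph = columns M , columnsInjective 3≤n

  -- Three distinct columns span at least seven vertices: three in a separating
  -- row a, and four in the other two rows σ 1, σ 2 (σ swaps 0 and a) since no
  -- two of the columns agree in both of them.
  sevenVertices : (s : Fin 3 → Fin n) → Injective _≡_ _≡_ s → 7 ≤ ∣ span (columns M ∘ s) ∣
  sevenVertices s s-inj = ≤-trans (sevenFromFour (size (V 1F)) (size (V 2F)) four)
    (blocksBound (span E) (σ ⟨$⟩ʳ_) (Injection.injective (↔⇒↣ σ))
      (λ i → proj₁ (V i)) (λ i → proj₁ (proj₂ (V i))) (λ i → valuesInSpan E (σ ⟨$⟩ʳ i) (V i)))
    where
    E : Fin 3 → Edge 3 q
    E = columns M ∘ s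
    row : Fin 3 → Fin 3 → Fin q
    row j k = M j (s k)
    a : Fin 3
    a = proj₁ (phf s s-inj)
    σ : Permutation 3 3
    σ = transpose 0F a
    apart : ∀ {k l} → k ≢ l → row (σ ⟨$⟩ʳ 1F) k ≡ row (σ ⟨$⟩ʳ 1F) l → row (σ ⟨$⟩ʳ 2F) k ≢ row (σ ⟨$⟩ʳ 2F) l
    apart k≢l agree₁ agree₂ = agreeOffRow 3≤n noUnique a (k≢l ∘ s-inj)
      (λ i i≢a → [ (λ { refl → agree₁ }) , (λ { refl → agree₂ }) ] (otherRows σ i i≢a))
    joint : Σ (Values (row (σ ⟨$⟩ʳ 1F)) × Values (row (σ ⟨$⟩ʳ 2F))) λ (v₁ , v₂) → 4 ≤ size v₁ + size v₂
    joint = jointValues _≟_ (row (σ ⟨$⟩ʳ 1F)) (row (σ ⟨$⟩ʳ 2F)) apart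
    V : (i : Fin 3) → Values (row (σ ⟨$⟩ʳ i))
    V 0F = values₃ (row a) (proj₂ (phf s s-inj))
    V 1F = proj₁ (proj₁ joint)
    V 2F = proj₂ (proj₁ joint)
    four : 4 ≤ size (V 1F) + size (V 2F)
    four = proj₂ joint
    sevenFromFour : ∀ b c → 4 ≤ b + c → 7 ≤ 3 + (b + (c + 0))
    sevenFromFour b c 4≤b+c = +-monoʳ-≤ 3 (subst (λ c′ → 4 ≤ b + c′) (sym (+-identityʳ c)) 4≤b+c)

  free : GFree 6 3 hypergraph
  free = sevenVertices

lemma5p3 : (q : ℕ) → 3 ≤ q →
    (a b c : ℕ) → IsMaxPHF* 3 3 q a → IsMaxF* 3 q 6 3 b → IsMaxPHF 3 3 q c →
    a ≤ b × b ≤ c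
lemma5p3 q 3≤q a b c ((M , phf , noUnique) , _) ((H , free) , maximalF) (_ , maximalP) = a≤b , b≤c
  where
  b≤c : b ≤ c
  b≤c = maximalP b (incidence H , freeIsPHF H free)
  2≤q : 2 ≤ q
  2≤q = ≤-trans (n≤1+n 2) 3≤q
  a≤b : a ≤ b
  a≤b with 3 ≤? a
  ... | yes 3≤a = maximalF a (PHF*IsFree.hypergraph M phf noUnique 3≤a , PHF*IsFree.free M phf noUnique 3≤a)
  ... | no 3≰a = ≤-trans (≤-pred (≰⇒> 3≰a)) (maximalF 2 (twoEdges 2 2≤q , fewEdgesFree 6 3 (twoEdges 2 2≤q) (n<1+n 2)))
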